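{- Let $k\ge 2$, $d=2k-1$, and let $a_1,\ldots,a_{k-1},m$ be integers with $m\ge 2$, $1\le a_i\le m/2$ and $\gcd(a_i,m)=1$ for each $i$. Let $$P=\mathrm{conv}\left\{\mathbf{0},\mathbf{e}_1,\ldots,\mathbf{e}_{d-1},\sum_{i=1}^{k-1}a_i\mathbf{e}_i+\sum_{j=k}^{d-1}(m-a_{d-j})\mathbf{e}_j+m\mathbf{e}_d\right\}\subset\mathbb{R}^d.$$ Then for a positive integer $n$, the polytope $nP$ has the integer decomposition property if and only if $n\ge k$.
   Context: $\mathbf{e}_1,\ldots,\mathbf{e}_d$ are the standard unit vectors of $\mathbb{R}^d$, $\mathbf{0}$ is the origin, and $nP=\{n\alpha:\alpha\in P\}$. An integral convex polytope $Q\subset\mathbb{R}^d$ has the integer decomposition property if for every integer $\ell\ge1$ and every $\gamma\in \ell Q\cap\mathbb{Z}^d$ there exist $\gamma^{(1)},\ldots,\gamma^{(\ell)}\in Q\cap\mathbb{Z}^d$ with $\gamma=\gamma^{(1)}+\cdots+\gamma^{(\ell)}$. -}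

module Defs where

open import Data.Nat as ℕ using (ℕ; zero; suc; _∸_; _<?_)
open import Data.Integer as ℤ using (ℤ; +_)
open import Data.Rational as ℚ using (ℚ; 0ℚ; 1ℚ; _/_)
open import Data.Fin using (Fin; zero; suc; toℕ; fromℕ<; _≟_)
open import Data.Product using (Σ; _×_)
open import Relation.Binary.PropositionalEquality using (_≡_)
open import Relation.Nullary using (yes; no)
open import Function using (_∘_)

sumℚ : ∀ {r} → (Fin r → ℚ) → ℚ
sumℚ {zero} f = 0ℚ
sumℚ {suc r} f = f zero ℚ.+ sumℚ (f ∘ suc)

sumℤ : ∀ {r} → (Fin r → ℤ) → ℤ
sumℤ {zero} f = + 0
sumℤ {suc r} f = f zero ℤ.+ sumℤ (f ∘ suc)

toℚ : ℤ → ℚ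
toℚ z = z / 1

Point : ℕ → Set
Point d = Fin d → ℚ

toQ : ∀ {d} → (Fin d → ℤ) → Point d
toQ γ i = toℚ (γ i)

-- a region in ℝ^d, represented by its rational points
Region : ℕ → Set₁
Region d = Point d → Set

conv : ∀ {r d} → (Fin r → Fin d → ℤ) → Region d
conv {r} V x = Σ (Fin r → ℚ) λ c →
  (∀ j → 0ℚ ℚ.≤ c j) × (sumℚ c ≡ 1ℚ) ×
  (∀ i → sumℚ (λ j → c j ℚ.* toℚ (V j i)) ≡ x i)

dil : ∀ {d} → ℕ → Region d → Region d
dil {d} n Q x = Σ (Point d) λ α → Q α × (∀ i → x i ≡ toℚ (+ n) ℚ.* α i)

IDP : ∀ {d} → Region d → Set
IDP {d} Q = (ℓ : ℕ) → 1 ℕ.≤ ℓ → (γ : Fin d → ℤ) → dil ℓ Q (toQ γ) →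
  Σ (Fin ℓ → Fin d → ℤ) λ gs →
    (∀ t → Q (toQ (gs t))) × (∀ i → γ i ≡ sumℤ (λ t → gs t i))

-- 1-based a_{t+1} for 0-based t (junk 0 outside range; never used there)
aAt : (k : ℕ) → (Fin (k ∸ 1) → ℕ) → ℕ → ℕ
aAt k a t with t <? k ∸ 1
... | yes p = a (fromℕ< p)
... | no _ = 0

dim : ℕ → ℕ
dim k = 2 ℕ.* k ∸ 1

-- the special vertex  Σ_{i<k} a_i e_i + Σ_{j=k}^{d-1} (m - a_{d-j}) e_j + m e_d
-- coordinate with 0-based index t (paper index t+1)
wvert : (k : ℕ) → (Fin (k ∸ 1) → ℕ) → ℕ → Fin (dim k) → ℤ
wvert k a m i with toℕ i <? k ∸ 1
... | yes _ = + aAt k a (toℕ i)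
... | no _ with toℕ i <? dim k ∸ 1
...   | yes _ = + m ℤ.- + aAt k a (2 ℕ.* k ∸ 3 ∸ toℕ i)
...   | no _ = + m

unit : ∀ {d} → Fin d → Fin d → ℤ
unit j i with i ≟ j
... | yes _ = + 1
... | no _ = + 0

vert : (k : ℕ) → (Fin (k ∸ 1) → ℕ) → ℕ → Fin (suc (dim k)) → Fin (dim k) → ℤ
vert k a m zero i = + 0
vert k a m (suc j) i with toℕ j <? dim k ∸ 1
... | yes _ = unit j i
... | no _ = wvert k a m i

P : (k : ℕ) → (Fin (k ∸ 1) → ℕ) → ℕ → Region (dim k)
P k a m = conv (vert k a m)

module Submission where

-- P is the simplex conv {0, e_1, …, e_{d−1}, w} with w_d = m. Clearing the denominator N·m from barycentric
-- coordinates, a lattice point y lies in N·P iff y_d ≥ 0, every slack m·y_i − y_d·w_i is ≥ 0, and the level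
-- Σ_i (m·y_i − y_d·w_i) + y_d is at most N·m. The coordinates w_1, …, w_{d−1} pair up as a_i and m − a_i, so the
-- slacks of each of the k − 1 pairs add up to a multiple of m. Hence a lattice point of level at least k·m has a
-- slack ≥ m or y_d ≥ m: a unit vector e_i or w (both of level m) can be subtracted without leaving the cone.
-- Peeling off such generators greedily splits any lattice point of ℓ·(nP) into ℓ lattice points of nP once n ≥ k.
-- Conversely, the all-ones vector lies in k·(nP), and in a decomposition into k lattice points of nP some summand
-- has last coordinate 1; then all its coordinates are ≥ 1, which pushes its level above (k − 1)·m, so n ≥ k.

open import Defs
open import Data.Nat using (ℕ; _≤_; _*_; _∸_)
open import Data.Nat.GCD using (gcd)
open import Data.Fin using (Fin)
open import Data.Product using (_×_)
open import Function.Bundles using (_⇔_)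
open import Relation.Binary.PropositionalEquality using (_≡_)

open import Data.Nat as ℕ using (zero; suc; _<?_)
import Data.Nat.Properties as ℕP
import Data.Nat.GCD as ℕG
open import Data.Integer as ℤ using (ℤ; +_)
import Data.Integer.Properties as ℤP
open import Data.Integer.Tactic.RingSolver using (solve-∀)
open import Data.Rational as ℚ using (ℚ; 0ℚ; 1ℚ)
open import Data.Rational.Solver using (module +-*-Solver)
import Data.Rational.Properties as ℚP
import Data.Rational.Unnormalised as ℚᵘ
import Data.Rational.Unnormalised.Properties as ℚᵘP
open import Data.Fin as Fin
  using (zero; suc; toℕ; inject₁; fromℕ; fromℕ<; _↑ˡ_; _↑ʳ_; opposite; cast)
open import Data.Fin.Properties
  using (toℕ-inject₁; toℕ<n; toℕ-fromℕ; toℕ-↑ˡ; toℕ-↑ʳ; toℕ-cast; cast-is-id; opposite-prop; fromℕ≢inject₁; inject₁-injective; any?)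
open import Data.Product using (Σ; ∃; _,_; proj₁; proj₂)
open import Data.Empty using (⊥; ⊥-elim)
open import Data.Vec.Functional using (_∷_; insertAt)
open import Data.Vec.Functional.Properties using (insertAt-lookup)
open import Function using (_∘_)
open import Algebra.Bundles using (CommutativeMonoid)
import Algebra.Properties.CommutativeSemigroup as CommSemigroupProperties
open import Function.Bundles using (mk⇔)
open import Relation.Nullary using (yes; no)
open import Relation.Binary.PropositionalEquality
  using (refl; sym; trans; cong; cong₂; subst; subst₂; module ≡-Reasoning)

open CommSemigroupProperties ℤP.+-commutativeSemigroup using () renaming (interchange to +-interchangeℤ)
open CommSemigroupProperties (CommutativeMonoid.commutativeSemigroup ℚP.+-0-commutativeMonoid)
  using () renaming (interchange to +-interchangeℚ)

-- The embedding ℤ → ℚ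

↥-toℚ : ∀ z → ℚ.↥ (toℚ z) ≡ z
↥-toℚ z = trans (sym (ℤP.*-identityʳ _))
  (trans (cong (λ g → ℚ.↥ (toℚ z) ℤ.* + g) (sym (ℕG.gcd-zeroʳ ℤ.∣ z ∣))) (ℚP.↥-/ z 1))

↧-toℚ : ∀ z → ℚ.↧ (toℚ z) ≡ + 1
↧-toℚ z = trans (sym (ℤP.*-identityʳ _))
  (trans (cong (λ g → ℚ.↧ (toℚ z) ℤ.* + g) (sym (ℕG.gcd-zeroʳ ℤ.∣ z ∣))) (ℚP.↧-/ z 1))

toℚᵘ-toℚ : ∀ z → ℚ.toℚᵘ (toℚ z) ℚᵘ.≃ ℚᵘ.mkℚᵘ z 0
toℚᵘ-toℚ z = ℚᵘ.*≡* (cong₂ ℤ._*_ (trans (ℚP.↥ᵘ-toℚᵘ (toℚ z)) (↥-toℚ z))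
                                  (sym (trans (ℚP.↧ᵘ-toℚᵘ (toℚ z)) (↧-toℚ z))))

toℚ-+ : ∀ a b → toℚ (a ℤ.+ b) ≡ toℚ a ℚ.+ toℚ b
toℚ-+ a b = ℚP.toℚᵘ-injective (ℚᵘP.≃-trans (toℚᵘ-toℚ (a ℤ.+ b)) (ℚᵘP.≃-sym
  (ℚᵘP.≃-trans (ℚP.toℚᵘ-homo-+ (toℚ a) (toℚ b))
  (ℚᵘP.≃-trans (ℚᵘP.+-cong (toℚᵘ-toℚ a) (toℚᵘ-toℚ b)) (ℚᵘ.*≡* (lemma a b))))))
  where
  lemma : ∀ a b → (a ℤ.* + 1 ℤ.+ b ℤ.* + 1) ℤ.* + 1 ≡ (a ℤ.+ b) ℤ.* + 1
  lemma = solve-∀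

toℚ-* : ∀ a b → toℚ (a ℤ.* b) ≡ toℚ a ℚ.* toℚ b
toℚ-* a b = ℚP.toℚᵘ-injective (ℚᵘP.≃-trans (toℚᵘ-toℚ (a ℤ.* b)) (ℚᵘP.≃-sym
  (ℚᵘP.≃-trans (ℚP.toℚᵘ-homo-* (toℚ a) (toℚ b))
  (ℚᵘP.≃-trans (ℚᵘP.*-cong (toℚᵘ-toℚ a) (toℚᵘ-toℚ b)) (ℚᵘ.*≡* refl)))))

toℚ-neg : ∀ a → toℚ (ℤ.- a) ≡ ℚ.- toℚ a
toℚ-neg a = ℚP.toℚᵘ-injective (ℚᵘP.≃-trans (toℚᵘ-toℚ (ℤ.- a)) (ℚᵘP.≃-sym
  (ℚᵘP.≃-trans (ℚP.toℚᵘ-homo‿- (toℚ a))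
  (ℚᵘP.≃-trans (ℚᵘP.-‿cong (toℚᵘ-toℚ a)) (ℚᵘ.*≡* refl)))))

toℚ-minus : ∀ a b → toℚ (a ℤ.- b) ≡ toℚ a ℚ.- toℚ b
toℚ-minus a b = trans (toℚ-+ a (ℤ.- b)) (cong (toℚ a ℚ.+_) (toℚ-neg b))

toℚ-pos-* : ∀ ℓ n → toℚ (+ (ℓ ℕ.* n)) ≡ toℚ (+ ℓ) ℚ.* toℚ (+ n)
toℚ-pos-* ℓ n = trans (cong toℚ (ℤP.pos-* ℓ n)) (toℚ-* (+ ℓ) (+ n))

toℚ-mono-≤ : ∀ {a b} → a ℤ.≤ b → toℚ a ℚ.≤ toℚ b
toℚ-mono-≤ {a} {b} a≤b = ℚ.*≤* (subst₂ ℤ._≤_ (cross a b) (cross b a) (ℤP.*-monoʳ-≤-nonNeg (+ 1) a≤b))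
  where
  cross : ∀ a b → a ℤ.* + 1 ≡ ℚ.↥ (toℚ a) ℤ.* ℚ.↧ (toℚ b)
  cross a b = sym (cong₂ ℤ._*_ (↥-toℚ a) (↧-toℚ b))

toℚ-cancel-≤ : ∀ {a b} → toℚ a ℚ.≤ toℚ b → a ℤ.≤ b
toℚ-cancel-≤ {a} {b} (ℚ.*≤* p) = subst₂ ℤ._≤_ (cross a b) (cross b a) p
  where
  cross : ∀ a b → ℚ.↥ (toℚ a) ℤ.* ℚ.↧ (toℚ b) ≡ a
  cross a b = trans (cong₂ ℤ._*_ (↥-toℚ a) (↧-toℚ b)) (ℤP.*-identityʳ a)

toℚ-nonNeg : ∀ n → 0ℚ ℚ.≤ toℚ (+ n)
toℚ-nonNeg n = toℚ-mono-≤ {+ 0} {+ n} (ℤ.+≤+ ℕ.z≤n)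

toℚ-pos : ∀ n .{{_ : ℕ.NonZero n}} → ℚ.Positive (toℚ (+ n))
toℚ-pos (suc k) = ℚ.positive {toℚ (+ suc k)} (ℚ.*<* (subst₂ ℤ._<_ (sym (cong (+ 0 ℤ.*_) (↧-toℚ (+ suc k))))
  (sym (trans (cong (ℤ._* + 1) (↥-toℚ (+ suc k))) (ℤP.*-identityʳ (+ suc k)))) (ℤ.+<+ (ℕ.s≤s ℕ.z≤n))))

0≤*ℚ : ∀ {p q} → 0ℚ ℚ.≤ p → 0ℚ ℚ.≤ q → 0ℚ ℚ.≤ p ℚ.* q
0≤*ℚ {p} {q} 0≤p 0≤q =
  subst (ℚ._≤ p ℚ.* q) (ℚP.*-zeroʳ p) (ℚP.*-monoˡ-≤-nonNeg p {{ℚ.nonNegative 0≤p}} 0≤q)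

≤-by-slackℚ : ∀ {p q} s → 0ℚ ℚ.≤ s → q ≡ p ℚ.+ s → p ℚ.≤ q
≤-by-slackℚ {p} s 0≤s q≡p+s =
  subst₂ ℚ._≤_ (ℚP.+-identityʳ p) (sym q≡p+s) (ℚP.+-monoʳ-≤ p 0≤s)

≤⇒0≤-ℚ : ∀ {p q} → p ℚ.≤ q → 0ℚ ℚ.≤ q ℚ.- p
≤⇒0≤-ℚ {p} {q} p≤q = subst (ℚ._≤ q ℚ.- p) (ℚP.+-inverseʳ p) (ℚP.+-monoˡ-≤ (ℚ.- p) p≤q)

-‿interchangeℤ : ∀ a b c d → (a ℤ.- b) ℤ.+ (c ℤ.- d) ≡ (a ℤ.+ c) ℤ.- (b ℤ.+ d)
-‿interchangeℤ = solve-∀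

i≡j+[i-j] : ∀ i j → i ≡ j ℤ.+ (i ℤ.- j)
i≡j+[i-j] = solve-∀

0≤*ℤ : ∀ {i j} → + 0 ℤ.≤ i → + 0 ℤ.≤ j → + 0 ℤ.≤ i ℤ.* j
0≤*ℤ {+ i} {+ j} _ _ = subst (+ 0 ℤ.≤_) (ℤP.pos-* i j) (ℤ.+≤+ ℕ.z≤n)

0≤+ℤ : ∀ {i j} → + 0 ℤ.≤ i → + 0 ℤ.≤ j → + 0 ℤ.≤ i ℤ.+ j
0≤+ℤ = ℤP.+-mono-≤

≤-by-slackℤ : ∀ {i j} s → + 0 ℤ.≤ s → j ≡ i ℤ.+ s → i ℤ.≤ j
≤-by-slackℤ {i} s 0≤s j≡i+s = subst₂ ℤ._≤_ (ℤP.+-identityʳ i) (sym j≡i+s) (ℤP.+-monoʳ-≤ i 0≤s)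

0≤-⇒≤ : ∀ {i j} → + 0 ℤ.≤ j ℤ.- i → i ℤ.≤ j
0≤-⇒≤ {i} {j} 0≤j-i = ≤-by-slackℤ (j ℤ.- i) 0≤j-i (i≡j+[i-j] j i)

<⇒0≤-suc : ∀ {i j} → i ℤ.< j → + 0 ℤ.≤ j ℤ.- (i ℤ.+ + 1)
<⇒0≤-suc {i} {j} i<j = ℤP.i≤j⇒0≤j-i (subst (ℤ._≤ j) (ℤP.+-comm (+ 1) i) (ℤP.i<j⇒suc[i]≤j i<j))

nonNeg≢-1 : ∀ {s} → + 0 ℤ.≤ s → s ≡ ℤ.- + 1 → ⊥
nonNeg≢-1 0≤s refl with 0≤s
... | ()

inject₁-fromℕ-elim : ∀ {n} (P : Fin (suc n) → Set) → (∀ j → P (inject₁ j)) → P (fromℕ n) → ∀ i → P i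
inject₁-fromℕ-elim {zero} P _ P-last zero = P-last
inject₁-fromℕ-elim {suc n} P P-inject₁ _ zero = P-inject₁ zero
inject₁-fromℕ-elim {suc n} P P-inject₁ P-last (suc i) = inject₁-fromℕ-elim (P ∘ suc) (P-inject₁ ∘ suc) P-last i

insertAt-fromℕ-inject₁ : ∀ {A : Set} {n} (f : Fin n → A) a j → insertAt f (fromℕ n) a (inject₁ j) ≡ f j
insertAt-fromℕ-inject₁ f a zero = refl
insertAt-fromℕ-inject₁ f a (suc j) = insertAt-fromℕ-inject₁ (f ∘ suc) a j

-- Finite sums and unit vectors

sumℚ-cong : ∀ {r} {f g : Fin r → ℚ} → (∀ j → f j ≡ g j) → sumℚ f ≡ sumℚ g
sumℚ-cong {zero} f≗g = refl
sumℚ-cong {suc r} f≗g = cong₂ ℚ._+_ (f≗g zero) (sumℚ-cong (f≗g ∘ suc))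

sumℚ-zero : ∀ {r} (f : Fin r → ℚ) → (∀ j → f j ≡ 0ℚ) → sumℚ f ≡ 0ℚ
sumℚ-zero {zero} f f≗0 = refl
sumℚ-zero {suc r} f f≗0 = trans (cong₂ ℚ._+_ (f≗0 zero) (sumℚ-zero (f ∘ suc) (f≗0 ∘ suc))) (ℚP.+-identityˡ 0ℚ)

sumℚ-distrib-+ : ∀ {r} (f g : Fin r → ℚ) → sumℚ (λ j → f j ℚ.+ g j) ≡ sumℚ f ℚ.+ sumℚ g
sumℚ-distrib-+ {zero} f g = refl
sumℚ-distrib-+ {suc r} f g =
  trans (cong ((f zero ℚ.+ g zero) ℚ.+_) (sumℚ-distrib-+ (f ∘ suc) (g ∘ suc)))
        (+-interchangeℚ (f zero) (g zero) (sumℚ (f ∘ suc)) (sumℚ (g ∘ suc)))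

*-distribˡ-sumℚ : ∀ {r} p (f : Fin r → ℚ) → sumℚ (λ j → p ℚ.* f j) ≡ p ℚ.* sumℚ f
*-distribˡ-sumℚ {zero} p f = sym (ℚP.*-zeroʳ p)
*-distribˡ-sumℚ {suc r} p f = trans (cong ((p ℚ.* f zero) ℚ.+_) (*-distribˡ-sumℚ p (f ∘ suc)))
  (sym (ℚP.*-distribˡ-+ p (f zero) (sumℚ (f ∘ suc))))

sumℚ-init-last : ∀ {r} (f : Fin (suc r) → ℚ) → sumℚ f ≡ sumℚ (f ∘ inject₁) ℚ.+ f (fromℕ r)
sumℚ-init-last {zero} f = trans (ℚP.+-identityʳ (f zero)) (sym (ℚP.+-identityˡ (f zero)))
sumℚ-init-last {suc r} f =
  trans (cong (f zero ℚ.+_) (sumℚ-init-last (f ∘ suc))) (sym (ℚP.+-assoc (f zero) _ _))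

sumℤ-cong : ∀ {r} {f g : Fin r → ℤ} → (∀ j → f j ≡ g j) → sumℤ f ≡ sumℤ g
sumℤ-cong {zero} f≗g = refl
sumℤ-cong {suc r} f≗g = cong₂ ℤ._+_ (f≗g zero) (sumℤ-cong (f≗g ∘ suc))

sumℤ-distrib-+ : ∀ {r} (f g : Fin r → ℤ) → sumℤ (λ j → f j ℤ.+ g j) ≡ sumℤ f ℤ.+ sumℤ g
sumℤ-distrib-+ {zero} f g = refl
sumℤ-distrib-+ {suc r} f g =
  trans (cong (λ u → (f zero ℤ.+ g zero) ℤ.+ u) (sumℤ-distrib-+ (f ∘ suc) (g ∘ suc)))
        (+-interchangeℤ (f zero) (g zero) (sumℤ (f ∘ suc)) (sumℤ (g ∘ suc)))

sumℤ-distrib-minus : ∀ {r} (f g : Fin r → ℤ) → sumℤ (λ j → f j ℤ.- g j) ≡ sumℤ f ℤ.- sumℤ g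
sumℤ-distrib-minus {zero} f g = refl
sumℤ-distrib-minus {suc r} f g =
  trans (cong (λ u → (f zero ℤ.- g zero) ℤ.+ u) (sumℤ-distrib-minus (f ∘ suc) (g ∘ suc)))
        (-‿interchangeℤ (f zero) (g zero) (sumℤ (f ∘ suc)) (sumℤ (g ∘ suc)))

*-distribˡ-sumℤ : ∀ {r} c (f : Fin r → ℤ) → sumℤ (λ j → c ℤ.* f j) ≡ c ℤ.* sumℤ f
*-distribˡ-sumℤ {zero} c f = sym (ℤP.*-zeroʳ c)
*-distribˡ-sumℤ {suc r} c f = trans (cong (λ u → c ℤ.* f zero ℤ.+ u) (*-distribˡ-sumℤ c (f ∘ suc)))
  (sym (ℤP.*-distribˡ-+ c (f zero) (sumℤ (f ∘ suc))))

sumℤ-const : ∀ r c → sumℤ {r} (λ _ → c) ≡ + r ℤ.* c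
sumℤ-const zero c = sym (ℤP.*-zeroˡ c)
sumℤ-const (suc r) c = trans (cong (λ u → c ℤ.+ u) (sumℤ-const r c)) (expand c (+ r))
  where
  expand : ∀ c r → c ℤ.+ r ℤ.* c ≡ (+ 1 ℤ.+ r) ℤ.* c
  expand = solve-∀

sumℤ-ones : ∀ r → sumℤ {r} (λ _ → + 1) ≡ + r
sumℤ-ones r = trans (sumℤ-const r (+ 1)) (ℤP.*-identityʳ (+ r))

sumℤ-zero : ∀ {r} (f : Fin r → ℤ) → (∀ j → f j ≡ + 0) → sumℤ f ≡ + 0
sumℤ-zero {r} f f≗0 = trans (sumℤ-cong f≗0) (trans (sumℤ-const r (+ 0)) (ℤP.*-zeroʳ (+ r)))

sumℤ-mono-≤ : ∀ {r} (f g : Fin r → ℤ) → (∀ j → f j ℤ.≤ g j) → sumℤ f ℤ.≤ sumℤ g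
sumℤ-mono-≤ {zero} f g f≤g = ℤP.≤-refl
sumℤ-mono-≤ {suc r} f g f≤g = ℤP.+-mono-≤ (f≤g zero) (sumℤ-mono-≤ (f ∘ suc) (g ∘ suc) (f≤g ∘ suc))

sumℤ-nonNeg : ∀ {r} (f : Fin r → ℤ) → (∀ j → + 0 ℤ.≤ f j) → + 0 ℤ.≤ sumℤ f
sumℤ-nonNeg {zero} f 0≤f = ℤP.≤-refl
sumℤ-nonNeg {suc r} f 0≤f = 0≤+ℤ (0≤f zero) (sumℤ-nonNeg (f ∘ suc) (0≤f ∘ suc))

sumℤ-init-last : ∀ {r} (f : Fin (suc r) → ℤ) → sumℤ f ≡ sumℤ (f ∘ inject₁) ℤ.+ f (fromℕ r)
sumℤ-init-last {zero} f = trans (ℤP.+-identityʳ (f zero)) (sym (ℤP.+-identityˡ (f zero)))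
sumℤ-init-last {suc r} f =
  trans (cong (λ u → f zero ℤ.+ u) (sumℤ-init-last (f ∘ suc))) (sym (ℤP.+-assoc (f zero) _ _))

sumℤ-opposite : ∀ {r} (f : Fin r → ℤ) → sumℤ f ≡ sumℤ (f ∘ opposite)
sumℤ-opposite {zero} f = refl
sumℤ-opposite {suc r} f = trans (sumℤ-init-last f)
  (trans (cong (ℤ._+ f (fromℕ r)) (sumℤ-opposite (f ∘ inject₁)))
         (ℤP.+-comm (sumℤ (f ∘ inject₁ ∘ opposite)) (f (fromℕ r))))

sumℤ-↑ : ∀ r s (f : Fin (r ℕ.+ s) → ℤ) → sumℤ f ≡ sumℤ (λ i → f (i ↑ˡ s)) ℤ.+ sumℤ (λ j → f (r ↑ʳ j))
sumℤ-↑ zero s f = sym (ℤP.+-identityˡ (sumℤ f))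
sumℤ-↑ (suc r) s f = trans (cong (λ u → f zero ℤ.+ u) (sumℤ-↑ r s (f ∘ suc)))
  (sym (ℤP.+-assoc (f zero) (sumℤ (λ i → f (suc (i ↑ˡ s)))) (sumℤ (λ j → f (suc (r ↑ʳ j))))))

sumℤ-cast : ∀ {r s} (e : r ≡ s) (f : Fin s → ℤ) → sumℤ f ≡ sumℤ (f ∘ cast e)
sumℤ-cast refl f = sumℤ-cong (λ i → cong f (sym (cast-is-id refl i)))

toℚ-sumℤ : ∀ {r} (f : Fin r → ℤ) → toℚ (sumℤ f) ≡ sumℚ (toℚ ∘ f)
toℚ-sumℤ {zero} f = refl
toℚ-sumℤ {suc r} f = trans (toℚ-+ (f zero) (sumℤ (f ∘ suc))) (cong (toℚ (f zero) ℚ.+_) (toℚ-sumℤ (f ∘ suc)))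

sumℤ≡1⇒∃≡1 : ∀ {r} (f : Fin r → ℤ) → (∀ j → + 0 ℤ.≤ f j) → sumℤ f ≡ + 1 → ∃ λ j → f j ≡ + 1
sumℤ≡1⇒∃≡1 {suc r} f 0≤f Σf≡1 with f zero in f₀≡ | 0≤f zero
... | + 0 | _ = let j , fj≡1 = sumℤ≡1⇒∃≡1 (f ∘ suc) (0≤f ∘ suc) (trans (sym (ℤP.+-identityˡ _)) Σf≡1)
                in suc j , fj≡1
... | + 1 | _ = zero , f₀≡
... | + suc (suc n) | _ = ⊥-elim (nonNeg≢-1 (0≤+ℤ (sumℤ-nonNeg (f ∘ suc) (0≤f ∘ suc)) (ℤ.+≤+ (ℕ.z≤n {n})))
      (trans (sym (cancel (sumℤ (f ∘ suc)) (+ n))) (cong (ℤ._- + 2) Σf≡1)))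
  where
  cancel : ∀ s n → (+ 2 ℤ.+ n ℤ.+ s) ℤ.- + 2 ≡ s ℤ.+ n
  cancel = solve-∀

unit-suc : ∀ {d} (j i : Fin d) → unit (suc j) (suc i) ≡ unit j i
unit-suc j i with i Fin.≟ j
... | yes _ = refl
... | no _ = refl

unit-nonNeg : ∀ {d} (j i : Fin d) → + 0 ℤ.≤ unit j i
unit-nonNeg j i with i Fin.≟ j
... | yes _ = ℤ.+≤+ ℕ.z≤n
... | no _ = ℤ.+≤+ ℕ.z≤n

unit-inject₁-last : ∀ {d} (j : Fin d) → unit (inject₁ j) (fromℕ d) ≡ + 0
unit-inject₁-last {d} j with fromℕ d Fin.≟ inject₁ j
... | yes p = ⊥-elim (fromℕ≢inject₁ p)
... | no _ = refl

sumℤ-unit : ∀ {r} (j : Fin r) → sumℤ (λ i → unit (inject₁ j) (inject₁ i)) ≡ + 1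
sumℤ-unit {suc r} zero = cong (λ u → + 1 ℤ.+ u) (sumℤ-zero {r} _ (λ _ → refl))
sumℤ-unit {suc r} (suc j) = trans (ℤP.+-identityˡ _)
  (trans (sumℤ-cong (λ i → unit-suc (inject₁ j) (inject₁ i))) (sumℤ-unit j))

sumℚ-unit-inject₁ : ∀ {r} (f : Fin r → ℚ) (i : Fin r) →
  sumℚ (λ j → f j ℚ.* toℚ (unit (inject₁ j) (inject₁ i))) ≡ f i
sumℚ-unit-inject₁ {suc r} f zero =
  trans (cong₂ ℚ._+_ (ℚP.*-identityʳ (f zero)) (sumℚ-zero _ (λ j → ℚP.*-zeroʳ (f (suc j)))))
        (ℚP.+-identityʳ (f zero))
sumℚ-unit-inject₁ {suc r} f (suc i) =
  trans (cong₂ ℚ._+_ (ℚP.*-zeroʳ (f zero))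
          (sumℚ-cong (λ j → cong (λ u → f (suc j) ℚ.* toℚ u) (unit-suc (inject₁ j) (inject₁ i)))))
        (trans (ℚP.+-identityˡ _) (sumℚ-unit-inject₁ (f ∘ suc) i))

sumℚ-unit-last : ∀ {r} (f : Fin r → ℚ) → sumℚ (λ j → f j ℚ.* toℚ (unit (inject₁ j) (fromℕ r))) ≡ 0ℚ
sumℚ-unit-last f =
  sumℚ-zero _ (λ j → trans (cong (λ u → f j ℚ.* toℚ u) (unit-inject₁-last j)) (ℚP.*-zeroʳ (f j)))

dil-dil⇒dil-* : ∀ {d} (Q : Region d) ℓ n x → dil ℓ (dil n Q) x → dil (ℓ ℕ.* n) Q x
dil-dil⇒dil-* Q ℓ n x (β , (α , α∈Q , β≡nα) , x≡ℓβ) = α , α∈Q , λ i → begin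
  x i                                       ≡⟨ x≡ℓβ i ⟩
  toℚ (+ ℓ) ℚ.* β i                         ≡⟨ cong (toℚ (+ ℓ) ℚ.*_) (β≡nα i) ⟩
  toℚ (+ ℓ) ℚ.* (toℚ (+ n) ℚ.* α i)         ≡⟨ ℚP.*-assoc (toℚ (+ ℓ)) (toℚ (+ n)) (α i) ⟨
  toℚ (+ ℓ) ℚ.* toℚ (+ n) ℚ.* α i           ≡⟨ cong (ℚ._* α i) (toℚ-pos-* ℓ n) ⟨
  toℚ (+ (ℓ ℕ.* n)) ℚ.* α i                 ∎
  where open ≡-Reasoning

dil-*⇒dil-dil : ∀ {d} (Q : Region d) ℓ n x → dil (ℓ ℕ.* n) Q x → dil ℓ (dil n Q) x
dil-*⇒dil-dil Q ℓ n x (α , α∈Q , x≡ℓnα) = (λ i → toℚ (+ n) ℚ.* α i) , (α , α∈Q , λ i → refl) , λ i → begin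
  x i                                       ≡⟨ x≡ℓnα i ⟩
  toℚ (+ (ℓ ℕ.* n)) ℚ.* α i                 ≡⟨ cong (ℚ._* α i) (toℚ-pos-* ℓ n) ⟩
  toℚ (+ ℓ) ℚ.* toℚ (+ n) ℚ.* α i           ≡⟨ ℚP.*-assoc (toℚ (+ ℓ)) (toℚ (+ n)) (α i) ⟩
  toℚ (+ ℓ) ℚ.* (toℚ (+ n) ℚ.* α i)         ∎
  where open ≡-Reasoning

-- Lattice points of dilates of conv {0, e_j, w}

module Simplex {D : ℕ} (w : Fin (suc D) → ℤ) (m : ℕ) (w-top : w (fromℕ D) ≡ + m) where

  ℤᵈ : Set
  ℤᵈ = Fin (suc D) → ℤ

  top : Fin (suc D)
  top = fromℕ D

  _+ᵥ_ _-ᵥ_ : ℤᵈ → ℤᵈ → ℤᵈ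
  (x +ᵥ y) i = x i ℤ.+ y i
  (x -ᵥ y) i = x i ℤ.- y i

  0ᵥ : ℤᵈ
  0ᵥ _ = + 0

  e : Fin D → ℤᵈ
  e j = unit (inject₁ j)

  -- For y ∈ N·Δ, where Δ = conv {0, e_j, w}, the barycentric coordinates of y / N at e_j, w and 0
  -- are slack y j, y top and N m − level y, each divided by N m.
  slack : ℤᵈ → Fin D → ℤ
  slack y j = + m ℤ.* y (inject₁ j) ℤ.- y top ℤ.* w (inject₁ j)

  level : ℤᵈ → ℤ
  level y = sumℤ (slack y) ℤ.+ y top

  record InCone (y : ℤᵈ) : Set where
    constructor cone
    field
      top-nonNeg : + 0 ℤ.≤ y top
      slack-nonNeg : ∀ j → + 0 ℤ.≤ slack y j

  record InDilate (N : ℕ) (y : ℤᵈ) : Set where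
    constructor dilate
    field
      in-cone : InCone y
      level-≤ : level y ℤ.≤ + N ℤ.* + m

  open InCone public
  open InDilate public

  slack-+ : ∀ x y j → slack (x +ᵥ y) j ≡ slack x j ℤ.+ slack y j
  slack-+ x y j = expand (+ m) (x (inject₁ j)) (y (inject₁ j)) (x top) (y top) (w (inject₁ j))
    where
    expand : ∀ m xj yj xt yt wj →
      m ℤ.* (xj ℤ.+ yj) ℤ.- (xt ℤ.+ yt) ℤ.* wj ≡ (m ℤ.* xj ℤ.- xt ℤ.* wj) ℤ.+ (m ℤ.* yj ℤ.- yt ℤ.* wj)
    expand = solve-∀

  slack-minus : ∀ x y j → slack (x -ᵥ y) j ≡ slack x j ℤ.- slack y j
  slack-minus x y j = expand (+ m) (x (inject₁ j)) (y (inject₁ j)) (x top) (y top) (w (inject₁ j))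
    where
    expand : ∀ m xj yj xt yt wj →
      m ℤ.* (xj ℤ.- yj) ℤ.- (xt ℤ.- yt) ℤ.* wj ≡ (m ℤ.* xj ℤ.- xt ℤ.* wj) ℤ.- (m ℤ.* yj ℤ.- yt ℤ.* wj)
    expand = solve-∀

  level-+ : ∀ x y → level (x +ᵥ y) ≡ level x ℤ.+ level y
  level-+ x y = trans (cong (ℤ._+ (x top ℤ.+ y top))
      (trans (sumℤ-cong (slack-+ x y)) (sumℤ-distrib-+ (slack x) (slack y))))
    (+-interchangeℤ (sumℤ (slack x)) (sumℤ (slack y)) (x top) (y top))

  level-minus : ∀ x y → level (x -ᵥ y) ≡ level x ℤ.- level y
  level-minus x y = trans (cong (ℤ._+ (x top ℤ.- y top))
      (trans (sumℤ-cong (slack-minus x y)) (sumℤ-distrib-minus (slack x) (slack y))))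
    (-‿interchangeℤ (sumℤ (slack x)) (sumℤ (slack y)) (x top) (y top))

  slack-e : ∀ i j → slack (e i) j ≡ + m ℤ.* unit (inject₁ i) (inject₁ j)
  slack-e i j = trans (cong (λ t → + m ℤ.* e i (inject₁ j) ℤ.- t ℤ.* w (inject₁ j)) (unit-inject₁-last i))
    (cancel (+ m ℤ.* unit (inject₁ i) (inject₁ j)) (w (inject₁ j)))
    where
    cancel : ∀ a b → a ℤ.- + 0 ℤ.* b ≡ a
    cancel = solve-∀

  slack-w : ∀ j → slack w j ≡ + 0
  slack-w j = trans (cong (λ t → + m ℤ.* w (inject₁ j) ℤ.- t ℤ.* w (inject₁ j)) w-top)
    (ℤP.+-inverseʳ (+ m ℤ.* w (inject₁ j)))

  level-e : ∀ i → level (e i) ≡ + m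
  level-e i = begin
    sumℤ (slack (e i)) ℤ.+ e i top              ≡⟨ cong₂ ℤ._+_ (sumℤ-cong (slack-e i)) (unit-inject₁-last i) ⟩
    sumℤ (λ j → + m ℤ.* e i (inject₁ j)) ℤ.+ + 0 ≡⟨ ℤP.+-identityʳ _ ⟩
    sumℤ (λ j → + m ℤ.* e i (inject₁ j))        ≡⟨ *-distribˡ-sumℤ (+ m) (λ j → e i (inject₁ j)) ⟩
    + m ℤ.* sumℤ (λ j → e i (inject₁ j))        ≡⟨ cong (+ m ℤ.*_) (sumℤ-unit i) ⟩
    + m ℤ.* + 1                                 ≡⟨ ℤP.*-identityʳ (+ m) ⟩
    + m                                         ∎
    where open ≡-Reasoning

  level-w : level w ≡ + m
  level-w = trans (cong₂ ℤ._+_ (sumℤ-zero (slack w) slack-w) w-top) (ℤP.+-identityˡ (+ m))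

  slack-cong : ∀ {x y} → (∀ i → x i ≡ y i) → ∀ j → slack x j ≡ slack y j
  slack-cong x≗y j = cong₂ (λ a b → + m ℤ.* a ℤ.- b ℤ.* w (inject₁ j)) (x≗y (inject₁ j)) (x≗y top)

  level-cong : ∀ {x y} → (∀ i → x i ≡ y i) → level x ≡ level y
  level-cong x≗y = cong₂ ℤ._+_ (sumℤ-cong (slack-cong x≗y)) (x≗y top)

  InDilate-resp : ∀ {N x y} → (∀ i → x i ≡ y i) → InDilate N x → InDilate N y
  InDilate-resp {N} {x} {y} x≗y (dilate (cone t≥0 s≥0) l≤) = dilate
    (cone (subst (+ 0 ℤ.≤_) (x≗y top) t≥0)
          (λ j → subst (+ 0 ℤ.≤_) (slack-cong x≗y j) (s≥0 j)))
    (subst (ℤ._≤ + N ℤ.* + m) (level-cong x≗y) l≤)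

  InDilate-mono : ∀ {M N x} → M ℕ.≤ N → InDilate M x → InDilate N x
  InDilate-mono M≤N (dilate c l≤) = dilate c (ℤP.≤-trans l≤ (ℤP.*-monoʳ-≤-nonNeg (+ m) (ℤ.+≤+ M≤N)))

  InDilate-+ : ∀ {M N x y} → InDilate M x → InDilate N y → InDilate (M ℕ.+ N) (x +ᵥ y)
  InDilate-+ {M} {N} {x} {y} (dilate (cone xt xs) xl) (dilate (cone yt ys) yl) = dilate
    (cone (0≤+ℤ xt yt) (λ j → subst (+ 0 ℤ.≤_) (sym (slack-+ x y j)) (0≤+ℤ (xs j) (ys j))))
    (subst₂ ℤ._≤_ (sym (level-+ x y)) bound (ℤP.+-mono-≤ xl yl))
    where
    bound : + M ℤ.* + m ℤ.+ + N ℤ.* + m ≡ + (M ℕ.+ N) ℤ.* + m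
    bound = trans (sym (ℤP.*-distribʳ-+ (+ m) (+ M) (+ N))) (cong (ℤ._* + m) (ℤP.pos-+ M N))

  InDilate-0 : InDilate 0 0ᵥ
  InDilate-0 = dilate (cone ℤP.≤-refl (λ j → ℤP.≤-reflexive (sym (slack-0 j))))
    (ℤP.≤-reflexive (trans (cong (ℤ._+ + 0) (sumℤ-zero (slack 0ᵥ) slack-0)) (ℤP.*-zeroˡ (+ m))))
    where
    slack-0 : ∀ j → slack 0ᵥ j ≡ + 0
    slack-0 j = trans (cong (ℤ._- + 0 ℤ.* w (inject₁ j)) (ℤP.*-zeroʳ (+ m))) (ℤP.*-zeroˡ (w (inject₁ j)))

  InDilate-e : ∀ i → InDilate 1 (e i)
  InDilate-e i = dilate
    (cone (ℤP.≤-reflexive (sym (unit-inject₁-last i)))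
          (λ j → subst (+ 0 ℤ.≤_) (sym (slack-e i j)) (0≤*ℤ {+ m} (ℤ.+≤+ ℕ.z≤n) (unit-nonNeg (inject₁ i) (inject₁ j)))))
    (ℤP.≤-reflexive (trans (level-e i) (sym (ℤP.*-identityˡ (+ m)))))

  InDilate-w : InDilate 1 w
  InDilate-w = dilate
    (cone (subst (+ 0 ℤ.≤_) (sym w-top) (ℤ.+≤+ ℕ.z≤n)) (λ j → ℤP.≤-reflexive (sym (slack-w j))))
    (ℤP.≤-reflexive (trans level-w (sym (ℤP.*-identityˡ (+ m)))))

  InCone-−e : ∀ {x} i → InCone x → + m ℤ.≤ slack x i → InCone (x -ᵥ e i)
  InCone-−e {x} i (cone t≥0 s≥0) m≤slack = cone
    (subst (+ 0 ℤ.≤_) (sym (trans (cong (λ a → x top ℤ.- a) (unit-inject₁-last i)) (ℤP.+-identityʳ (x top)))) t≥0)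
    (λ j → subst (+ 0 ℤ.≤_) (sym (trans (slack-minus x (e i) j) (cong (λ a → slack x j ℤ.- a) (slack-e i j)))) (remaining j))
    where
    remaining : ∀ j → + 0 ℤ.≤ slack x j ℤ.- + m ℤ.* unit (inject₁ i) (inject₁ j)
    remaining j with inject₁ j Fin.≟ inject₁ i
    ... | yes p = subst (λ k → + 0 ℤ.≤ slack x k ℤ.- + m ℤ.* + 1) (sym (inject₁-injective p))
                    (ℤP.i≤j⇒0≤j-i (subst (ℤ._≤ slack x i) (sym (ℤP.*-identityʳ (+ m))) m≤slack))
    ... | no _ = subst (+ 0 ℤ.≤_) (sym (trans (cong (λ a → slack x j ℤ.- a) (ℤP.*-zeroʳ (+ m))) (ℤP.+-identityʳ _))) (s≥0 j)

  InCone-−w : ∀ {x} → InCone x → + m ℤ.≤ x top → InCone (x -ᵥ w)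
  InCone-−w {x} (cone t≥0 s≥0) m≤top = cone
    (subst (λ a → + 0 ℤ.≤ x top ℤ.- a) (sym w-top) (ℤP.i≤j⇒0≤j-i m≤top))
    (λ j → subst (+ 0 ℤ.≤_) (sym (trans (slack-minus x w j) (trans (cong (λ a → slack x j ℤ.- a) (slack-w j)) (ℤP.+-identityʳ _)))) (s≥0 j))

  toℚ-slack : ∀ y j → toℚ (slack y j) ≡ toℚ (+ m) ℚ.* toℚ (y (inject₁ j)) ℚ.- toℚ (y top) ℚ.* toℚ (w (inject₁ j))
  toℚ-slack y j = trans (toℚ-minus (+ m ℤ.* y (inject₁ j)) (y top ℤ.* w (inject₁ j)))
    (cong₂ ℚ._-_ (toℚ-* (+ m) (y (inject₁ j))) (toℚ-* (y top) (w (inject₁ j))))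

  toℚ-level : ∀ y → toℚ (level y) ≡ sumℚ (toℚ ∘ slack y) ℚ.+ toℚ (y top)
  toℚ-level y = trans (toℚ-+ (sumℤ (slack y)) (y top)) (cong (ℚ._+ toℚ (y top)) (toℚ-sumℤ (slack y)))

  module Vertices (V : Fin (suc (suc D)) → ℤᵈ)
    (V-origin : ∀ i → V zero i ≡ + 0)
    (V-unit : ∀ j i → V (suc (inject₁ j)) i ≡ e j i)
    (V-apex : ∀ i → V (suc top) i ≡ w i) where

    combination : (Fin (suc (suc D)) → ℚ) → Point (suc D)
    combination c i = sumℚ (λ j → c j ℚ.* toℚ (V j i))

    combination-split : ∀ c i → combination c i ≡
      sumℚ (λ j → c (suc (inject₁ j)) ℚ.* toℚ (e j i)) ℚ.+ c (suc top) ℚ.* toℚ (w i)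
    combination-split c i = begin
      c zero ℚ.* toℚ (V zero i) ℚ.+ sumℚ (λ j → c (suc j) ℚ.* toℚ (V (suc j) i))
        ≡⟨ cong₂ ℚ._+_ (trans (cong (λ v → c zero ℚ.* toℚ v) (V-origin i)) (ℚP.*-zeroʳ (c zero)))
                       (sumℚ-init-last (λ j → c (suc j) ℚ.* toℚ (V (suc j) i))) ⟩
      0ℚ ℚ.+ (sumℚ (λ j → c (suc (inject₁ j)) ℚ.* toℚ (V (suc (inject₁ j)) i)) ℚ.+ c (suc top) ℚ.* toℚ (V (suc top) i))
        ≡⟨ ℚP.+-identityˡ _ ⟩
      sumℚ (λ j → c (suc (inject₁ j)) ℚ.* toℚ (V (suc (inject₁ j)) i)) ℚ.+ c (suc top) ℚ.* toℚ (V (suc top) i)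
        ≡⟨ cong₂ ℚ._+_ (sumℚ-cong (λ j → cong (λ v → c (suc (inject₁ j)) ℚ.* toℚ v) (V-unit j i)))
                       (cong (λ v → c (suc top) ℚ.* toℚ v) (V-apex i)) ⟩
      sumℚ (λ j → c (suc (inject₁ j)) ℚ.* toℚ (e j i)) ℚ.+ c (suc top) ℚ.* toℚ (w i) ∎
      where open ≡-Reasoning

    combination-inject₁ : ∀ c i →
      combination c (inject₁ i) ≡ c (suc (inject₁ i)) ℚ.+ c (suc top) ℚ.* toℚ (w (inject₁ i))
    combination-inject₁ c i = trans (combination-split c (inject₁ i))
      (cong (ℚ._+ c (suc top) ℚ.* toℚ (w (inject₁ i))) (sumℚ-unit-inject₁ (λ j → c (suc (inject₁ j))) i))

    combination-top : ∀ c → combination c top ≡ c (suc top) ℚ.* toℚ (+ m)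
    combination-top c = trans (combination-split c top)
      (trans (cong₂ ℚ._+_ (sumℚ-unit-last (λ j → c (suc (inject₁ j)))) (cong (λ v → c (suc top) ℚ.* toℚ v) w-top))
             (ℚP.+-identityˡ _))

    sumℚ-split : ∀ (c : Fin (suc (suc D)) → ℚ) →
      sumℚ c ≡ c zero ℚ.+ (sumℚ (λ j → c (suc (inject₁ j))) ℚ.+ c (suc top))
    sumℚ-split c = cong (c zero ℚ.+_) (sumℚ-init-last (c ∘ suc))

    module ScaledCombination (N : ℕ) (c : Fin (suc (suc D)) → ℚ) (y : ℤᵈ)
      (y≡Nc : ∀ i → toℚ (y i) ≡ toℚ (+ N) ℚ.* combination c i) where

      N′ m′ μ : ℚ
      N′ = toℚ (+ N)
      m′ = toℚ (+ m)
      μ = c (suc top)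

      λ′ : Fin D → ℚ
      λ′ j = c (suc (inject₁ j))

      top-eq : toℚ (y top) ≡ N′ ℚ.* m′ ℚ.* μ
      top-eq = trans (y≡Nc top) (trans (cong (N′ ℚ.*_) (combination-top c)) (reorder N′ μ m′))
        where
        reorder : ∀ a b c → a ℚ.* (b ℚ.* c) ≡ a ℚ.* c ℚ.* b
        reorder = solve 3 (λ a b c → a :* (b :* c) := a :* c :* b) refl
          where open +-*-Solver

      slack-eq : ∀ j → toℚ (slack y j) ≡ N′ ℚ.* m′ ℚ.* λ′ j
      slack-eq j = begin
        toℚ (slack y j)                                         ≡⟨ toℚ-slack y j ⟩
        m′ ℚ.* toℚ (y (inject₁ j)) ℚ.- toℚ (y top) ℚ.* wj        ≡⟨ cong₂ (λ a b → m′ ℚ.* a ℚ.- b ℚ.* wj)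
                                                                     (trans (y≡Nc (inject₁ j)) (cong (N′ ℚ.*_) (combination-inject₁ c j))) top-eq ⟩
        m′ ℚ.* (N′ ℚ.* (λ′ j ℚ.+ μ ℚ.* wj)) ℚ.- N′ ℚ.* m′ ℚ.* μ ℚ.* wj
                                                                ≡⟨ cancel m′ N′ (λ′ j) μ wj ⟩
        N′ ℚ.* m′ ℚ.* λ′ j                                      ∎
        where
        open ≡-Reasoning
        wj = toℚ (w (inject₁ j))
        cancel : ∀ m n l u v → m ℚ.* (n ℚ.* (l ℚ.+ u ℚ.* v)) ℚ.- n ℚ.* m ℚ.* u ℚ.* v ≡ n ℚ.* m ℚ.* l
        cancel = solve 5 (λ m n l u v → m :* (n :* (l :+ u :* v)) :- n :* m :* u :* v := n :* m :* l) refl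
          where open +-*-Solver

      level-eq : toℚ (level y) ℚ.+ N′ ℚ.* m′ ℚ.* c zero ≡ N′ ℚ.* m′ ℚ.* sumℚ c
      level-eq = begin
        toℚ (level y) ℚ.+ Nm ℚ.* c zero
          ≡⟨ cong (ℚ._+ Nm ℚ.* c zero) (trans (toℚ-level y) (cong₂ ℚ._+_ (sumℚ-cong slack-eq) top-eq)) ⟩
        sumℚ (λ j → Nm ℚ.* λ′ j) ℚ.+ Nm ℚ.* μ ℚ.+ Nm ℚ.* c zero
          ≡⟨ cong (λ s → s ℚ.+ Nm ℚ.* μ ℚ.+ Nm ℚ.* c zero) (*-distribˡ-sumℚ Nm λ′) ⟩
        Nm ℚ.* sumℚ λ′ ℚ.+ Nm ℚ.* μ ℚ.+ Nm ℚ.* c zero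
          ≡⟨ factor Nm (sumℚ λ′) μ (c zero) ⟩
        Nm ℚ.* (c zero ℚ.+ (sumℚ λ′ ℚ.+ μ))
          ≡⟨ cong (Nm ℚ.*_) (sumℚ-split c) ⟨
        Nm ℚ.* sumℚ c ∎
        where
        open ≡-Reasoning
        Nm = N′ ℚ.* m′
        factor : ∀ q s u c → q ℚ.* s ℚ.+ q ℚ.* u ℚ.+ q ℚ.* c ≡ q ℚ.* (c ℚ.+ (s ℚ.+ u))
        factor = solve 4 (λ q s u c → q :* s :+ q :* u :+ q :* c := q :* (c :+ (s :+ u))) refl
          where open +-*-Solver

    ∈dil⇒InDilate : ∀ N y → dil N (conv V) (toQ y) → InDilate N y
    ∈dil⇒InDilate N y (α , (c , c≥0 , Σc≡1 , c≡α) , y≡Nα) = dilate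
      (cone (toℚ-cancel-≤ (subst (0ℚ ℚ.≤_) (sym top-eq) (0≤*ℚ 0≤Nm (c≥0 (suc top)))))
            (λ j → toℚ-cancel-≤ (subst (0ℚ ℚ.≤_) (sym (slack-eq j)) (0≤*ℚ 0≤Nm (c≥0 (suc (inject₁ j)))))))
      (toℚ-cancel-≤ (≤-by-slackℚ (N′ ℚ.* m′ ℚ.* c zero) (0≤*ℚ 0≤Nm (c≥0 zero))
        (trans (toℚ-* (+ N) (+ m)) (sym (trans level-eq (trans (cong (N′ ℚ.* m′ ℚ.*_) Σc≡1) (ℚP.*-identityʳ _)))))))
      where
      open ScaledCombination N c y (λ i → trans (y≡Nα i) (cong (toℚ (+ N) ℚ.*_) (sym (c≡α i))))
      0≤Nm : 0ℚ ℚ.≤ N′ ℚ.* m′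
      0≤Nm = 0≤*ℚ (toℚ-nonNeg N) (toℚ-nonNeg m)

    module Barycentric (r : ℚ) (y : ℤᵈ) where

      λ′ : Fin D → ℚ
      λ′ j = r ℚ.* toℚ (slack y j)

      μ : ℚ
      μ = r ℚ.* toℚ (y top)

      coefficients : Fin (suc (suc D)) → ℚ
      coefficients = (1ℚ ℚ.- r ℚ.* toℚ (level y)) ∷ insertAt λ′ (fromℕ D) μ

      coefficients-inject₁ : ∀ j → coefficients (suc (inject₁ j)) ≡ λ′ j
      coefficients-inject₁ = insertAt-fromℕ-inject₁ λ′ μ

      coefficients-top : coefficients (suc top) ≡ μ
      coefficients-top = insertAt-lookup λ′ (fromℕ D) μ

      coefficients-nonNeg : 0ℚ ℚ.≤ r → InCone y → r ℚ.* toℚ (level y) ℚ.≤ 1ℚ → ∀ j → 0ℚ ℚ.≤ coefficients j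
      coefficients-nonNeg 0≤r (cone top≥0 slack≥0) r·level≤1 = λ where
        zero → ≤⇒0≤-ℚ {r ℚ.* toℚ (level y)} {1ℚ} r·level≤1
        (suc i) → inject₁-fromℕ-elim (λ i → 0ℚ ℚ.≤ coefficients (suc i))
          (λ j → subst (0ℚ ℚ.≤_) (sym (coefficients-inject₁ j)) (0≤*ℚ 0≤r (toℚ-mono-≤ (slack≥0 j))))
          (subst (0ℚ ℚ.≤_) (sym coefficients-top) (0≤*ℚ 0≤r (toℚ-mono-≤ top≥0))) i

      sumℚ-coefficients≡1 : sumℚ coefficients ≡ 1ℚ
      sumℚ-coefficients≡1 = begin
        sumℚ coefficients
          ≡⟨ sumℚ-split coefficients ⟩
        c₀ ℚ.+ (sumℚ (λ j → coefficients (suc (inject₁ j))) ℚ.+ coefficients (suc top))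
          ≡⟨ cong₂ (λ s t → c₀ ℚ.+ (s ℚ.+ t))
               (trans (sumℚ-cong coefficients-inject₁) (*-distribˡ-sumℚ r (toℚ ∘ slack y))) coefficients-top ⟩
        c₀ ℚ.+ (r ℚ.* sumℚ (toℚ ∘ slack y) ℚ.+ r ℚ.* toℚ (y top))
          ≡⟨ cong (c₀ ℚ.+_) (trans (sym (ℚP.*-distribˡ-+ r _ _)) (cong (r ℚ.*_) (sym (toℚ-level y)))) ⟩
        (1ℚ ℚ.- r ℚ.* toℚ (level y)) ℚ.+ r ℚ.* toℚ (level y)
          ≡⟨ cancel 1ℚ (r ℚ.* toℚ (level y)) ⟩
        1ℚ ∎
        where
        open ≡-Reasoning
        c₀ = coefficients zero
        cancel : ∀ a b → (a ℚ.- b) ℚ.+ b ≡ a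
        cancel = solve 2 (λ a b → (a :- b) :+ b := a) refl
          where open +-*-Solver

      combination-coefficients : ∀ i → combination coefficients i ≡ r ℚ.* toℚ (+ m) ℚ.* toℚ (y i)
      combination-coefficients = inject₁-fromℕ-elim _ at-inject₁ at-top
        where
        at-inject₁ : ∀ j → combination coefficients (inject₁ j) ≡ r ℚ.* toℚ (+ m) ℚ.* toℚ (y (inject₁ j))
        at-inject₁ j = begin
          combination coefficients (inject₁ j)
            ≡⟨ combination-inject₁ coefficients j ⟩
          coefficients (suc (inject₁ j)) ℚ.+ coefficients (suc top) ℚ.* wj
            ≡⟨ cong₂ (λ a b → a ℚ.+ b ℚ.* wj) (trans (coefficients-inject₁ j) (cong (r ℚ.*_) (toℚ-slack y j))) coefficients-top ⟩
          r ℚ.* (toℚ (+ m) ℚ.* toℚ (y (inject₁ j)) ℚ.- toℚ (y top) ℚ.* wj) ℚ.+ r ℚ.* toℚ (y top) ℚ.* wj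
            ≡⟨ cancel r (toℚ (+ m)) (toℚ (y (inject₁ j))) (toℚ (y top)) wj ⟩
          r ℚ.* toℚ (+ m) ℚ.* toℚ (y (inject₁ j)) ∎
          where
          open ≡-Reasoning
          wj = toℚ (w (inject₁ j))
          cancel : ∀ r m y t v → r ℚ.* (m ℚ.* y ℚ.- t ℚ.* v) ℚ.+ r ℚ.* t ℚ.* v ≡ r ℚ.* m ℚ.* y
          cancel = solve 5 (λ r m y t v → r :* (m :* y :- t :* v) :+ r :* t :* v := r :* m :* y) refl
            where open +-*-Solver
        at-top : combination coefficients top ≡ r ℚ.* toℚ (+ m) ℚ.* toℚ (y top)
        at-top = trans (combination-top coefficients)
          (trans (cong (ℚ._* toℚ (+ m)) coefficients-top) (reorder r (toℚ (y top)) (toℚ (+ m))))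
          where
          reorder : ∀ a b c → a ℚ.* b ℚ.* c ≡ a ℚ.* c ℚ.* b
          reorder = solve 3 (λ a b c → a :* b :* c := a :* c :* b) refl
            where open +-*-Solver

    InDilate⇒∈dil : ∀ N → 1 ℕ.≤ N → 1 ℕ.≤ m → ∀ y → InDilate N y → dil N (conv V) (toQ y)
    InDilate⇒∈dil N 1≤N 1≤m y (dilate y-cone level≤) =
      α , (coefficients , coefficients-nonNeg 0≤r y-cone r·level≤1 , sumℚ-coefficients≡1 , combination-coefficients) ,
      y≡Nα
      where
      q : ℚ
      q = toℚ (+ N) ℚ.* toℚ (+ m)

      instance
        N≢0 : ℕ.NonZero N
        N≢0 = ℕ.>-nonZero 1≤N
        m≢0 : ℕ.NonZero m
        m≢0 = ℕ.>-nonZero 1≤m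
        q>0 : ℚ.Positive q
        q>0 = ℚP.pos*pos⇒pos (toℚ (+ N)) {{toℚ-pos N}} (toℚ (+ m)) {{toℚ-pos m}}
        q≢0 : ℚ.NonZero q
        q≢0 = ℚP.pos⇒nonZero q

      r : ℚ
      r = ℚ.1/ q

      open Barycentric r y

      0≤r : 0ℚ ℚ.≤ r
      0≤r = ℚP.nonNegative⁻¹ r {{ℚP.pos⇒nonNeg r {{ℚP.1/pos⇒pos q}}}}

      r·level≤1 : r ℚ.* toℚ (level y) ℚ.≤ 1ℚ
      r·level≤1 = subst (r ℚ.* toℚ (level y) ℚ.≤_) (trans (cong (r ℚ.*_) (toℚ-* (+ N) (+ m))) (ℚP.*-inverseˡ q))
        (ℚP.*-monoˡ-≤-nonNeg r {{ℚ.nonNegative 0≤r}} (toℚ-mono-≤ level≤))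

      α : Point (suc D)
      α i = r ℚ.* toℚ (+ m) ℚ.* toℚ (y i)

      y≡Nα : ∀ i → toQ y i ≡ toℚ (+ N) ℚ.* α i
      y≡Nα i = sym (trans (regroup (toℚ (+ N)) r (toℚ (+ m)) (toℚ (y i)))
        (trans (cong (ℚ._* toℚ (y i)) (ℚP.*-inverseʳ q)) (ℚP.*-identityˡ (toℚ (y i)))))
        where
        regroup : ∀ n r m y → n ℚ.* (r ℚ.* m ℚ.* y) ≡ n ℚ.* m ℚ.* r ℚ.* y
        regroup = solve 4 (λ n r m y → n :* (r :* m :* y) := n :* m :* r :* y) refl
          where open +-*-Solver

  module Paired (K : ℕ) (p₁ p₂ : Fin K → Fin D)
    (sumℤ-pairs : ∀ (f : Fin D → ℤ) → sumℤ f ≡ sumℤ (λ t → f (p₁ t) ℤ.+ f (p₂ t)))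
    (w-pairs : ∀ t → w (inject₁ (p₁ t)) ℤ.+ w (inject₁ (p₂ t)) ≡ + m) where

    pair-height : ℤᵈ → Fin K → ℤ
    pair-height x t = x (inject₁ (p₁ t)) ℤ.+ x (inject₁ (p₂ t)) ℤ.- x top

    slack-pair : ∀ x t → slack x (p₁ t) ℤ.+ slack x (p₂ t) ≡ + m ℤ.* pair-height x t
    slack-pair x t = begin
      slack x (p₁ t) ℤ.+ slack x (p₂ t)                  ≡⟨ expand (+ m) xa xb (x top) (w (inject₁ (p₁ t))) (w (inject₁ (p₂ t))) ⟩
      + m ℤ.* (xa ℤ.+ xb) ℤ.- x top ℤ.* (w (inject₁ (p₁ t)) ℤ.+ w (inject₁ (p₂ t)))
                                                          ≡⟨ cong (λ s → + m ℤ.* (xa ℤ.+ xb) ℤ.- x top ℤ.* s) (w-pairs t) ⟩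
      + m ℤ.* (xa ℤ.+ xb) ℤ.- x top ℤ.* + m               ≡⟨ collect (+ m) (xa ℤ.+ xb) (x top) ⟩
      + m ℤ.* pair-height x t                             ∎
      where
      open ≡-Reasoning
      xa = x (inject₁ (p₁ t))
      xb = x (inject₁ (p₂ t))
      expand : ∀ m a b t u v → (m ℤ.* a ℤ.- t ℤ.* u) ℤ.+ (m ℤ.* b ℤ.- t ℤ.* v) ≡ m ℤ.* (a ℤ.+ b) ℤ.- t ℤ.* (u ℤ.+ v)
      expand = solve-∀
      collect : ∀ m s t → m ℤ.* s ℤ.- t ℤ.* m ≡ m ℤ.* (s ℤ.- t)
      collect = solve-∀

    m*K+m≡[1+K]*m : + m ℤ.* + K ℤ.+ + m ≡ + (suc K) ℤ.* + m
    m*K+m≡[1+K]*m = trans (collect (+ m) (+ K)) (cong (ℤ._* + m) (sym (ℤP.pos-+ 1 K)))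
      where
      collect : ∀ m k → m ℤ.* k ℤ.+ m ≡ (+ 1 ℤ.+ k) ℤ.* m
      collect = solve-∀

    level-pairs : ∀ x → level x ≡ + m ℤ.* sumℤ (pair-height x) ℤ.+ x top
    level-pairs x = cong (ℤ._+ x top)
      (trans (sumℤ-pairs (slack x)) (trans (sumℤ-cong (slack-pair x)) (*-distribˡ-sumℤ (+ m) (pair-height x))))

    pair-height≤1 : ∀ x t → slack x (p₁ t) ℤ.< + m → slack x (p₂ t) ℤ.< + m → pair-height x t ℤ.≤ + 1
    pair-height≤1 x t a<m b<m = ℤP.i<j⇒i≤pred[j] (ℤP.*-cancelˡ-<-nonNeg (+ m)
      (subst₂ ℤ._<_ (slack-pair x t) (double (+ m)) (ℤP.+-mono-< a<m b<m)))
      where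
      double : ∀ a → a ℤ.+ a ≡ a ℤ.* + 2
      double = solve-∀

    small-slacks⇒level< : ∀ x → (∀ j → slack x j ℤ.< + m) → x top ℤ.< + m → level x ℤ.< + (suc K) ℤ.* + m
    small-slacks⇒level< x slack<m top<m = begin-strict
      level x                                   ≡⟨ level-pairs x ⟩
      + m ℤ.* sumℤ (pair-height x) ℤ.+ x top    ≤⟨ ℤP.+-monoˡ-≤ (x top) (ℤP.*-monoˡ-≤-nonNeg (+ m) Σheights≤K) ⟩
      + m ℤ.* + K ℤ.+ x top                     <⟨ ℤP.+-monoʳ-< (+ m ℤ.* + K) top<m ⟩
      + m ℤ.* + K ℤ.+ + m                       ≡⟨ m*K+m≡[1+K]*m ⟩
      + (suc K) ℤ.* + m                         ∎
      where
      open ℤP.≤-Reasoning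
      Σheights≤K : sumℤ (pair-height x) ℤ.≤ + K
      Σheights≤K = subst (sumℤ (pair-height x) ℤ.≤_) (sumℤ-ones K)
        (sumℤ-mono-≤ (pair-height x) (λ _ → + 1) (λ t → pair-height≤1 x t (slack<m (p₁ t)) (slack<m (p₂ t))))

    removable-generator : ∀ x → InCone x → + (suc K) ℤ.* + m ℤ.≤ level x →
      ∃ λ u → InDilate 1 u × level u ≡ + m × InCone (x -ᵥ u)
    removable-generator x x-cone big with + m ℤP.≤? x top
    ... | yes m≤top = w , InDilate-w , level-w , InCone-−w x-cone m≤top
    ... | no top≱m with any? (λ j → + m ℤP.≤? slack x j)
    ...   | yes (j , m≤slack) = e j , InDilate-e j , level-e j , InCone-−e j x-cone m≤slack
    ...   | no none = ⊥-elim (ℤP.<⇒≱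
            (small-slacks⇒level< x (λ j → ℤP.≰⇒> (λ m≤slack → none (j , m≤slack))) (ℤP.≰⇒> top≱m)) big)

    InDilate-split : ∀ p q → suc K ℕ.≤ q → ∀ x → InDilate (p ℕ.+ q) x →
      ∃ λ y → InDilate p y × InDilate q (x -ᵥ y)
    InDilate-split zero q _ x x∈ = 0ᵥ , InDilate-0 , InDilate-resp (λ i → sym (ℤP.+-identityʳ (x i))) x∈
    InDilate-split (suc p) q K<q x (dilate x-cone level≤) with level x ℤP.≤? + (p ℕ.+ q) ℤ.* + m
    ... | yes fits =
      let y , y∈ , rest∈ = InDilate-split p q K<q x (dilate x-cone fits)
      in y , InDilate-mono (ℕP.n≤1+n p) y∈ , rest∈
    ... | no overflows =
      let u , u∈ , level-u , rest-cone = removable-generator x x-cone big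
          y , y∈ , rest∈ = InDilate-split p q K<q (x -ᵥ u) (dilate rest-cone (lowered {u} level-u))
      in (u +ᵥ y) , InDilate-+ u∈ y∈ , InDilate-resp (λ i → regroup (x i) (u i) (y i)) rest∈
      where
      big : + (suc K) ℤ.* + m ℤ.≤ level x
      big = ℤP.≤-trans (ℤP.*-monoʳ-≤-nonNeg (+ m) (ℤ.+≤+ (ℕP.≤-trans K<q (ℕP.m≤n+m q p))))
                       (ℤP.<⇒≤ (ℤP.≰⇒> overflows))
      lowered : ∀ {u} → level u ≡ + m → level (x -ᵥ u) ℤ.≤ + (p ℕ.+ q) ℤ.* + m
      lowered {u} level-u = subst (ℤ._≤ + (p ℕ.+ q) ℤ.* + m)
        (sym (trans (level-minus x u) (cong (λ l → level x ℤ.- l) level-u)))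
        (≤-by-slackℤ (+ (suc (p ℕ.+ q)) ℤ.* + m ℤ.- level x) (ℤP.i≤j⇒0≤j-i level≤)
          (trans (shift (level x) (+ (p ℕ.+ q)) (+ m))
                 (cong (λ k → (level x ℤ.- + m) ℤ.+ (k ℤ.* + m ℤ.- level x)) (sym (ℤP.pos-+ 1 (p ℕ.+ q))))))
        where
        shift : ∀ l n m → n ℤ.* m ≡ (l ℤ.- m) ℤ.+ ((+ 1 ℤ.+ n) ℤ.* m ℤ.- l)
        shift = solve-∀
      regroup : ∀ a b c → (a ℤ.- b) ℤ.- c ≡ a ℤ.- (b ℤ.+ c)
      regroup = solve-∀

    decompose : ∀ n → suc K ℕ.≤ n → ∀ ℓ x → InDilate (suc ℓ ℕ.* n) x →
      Σ (Fin (suc ℓ) → ℤᵈ) λ ys → (∀ t → InDilate n (ys t)) × (∀ i → x i ≡ sumℤ (λ t → ys t i))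
    decompose n K<n zero x x∈ =
      (λ _ → x) , (λ _ → subst (λ N → InDilate N x) (ℕP.+-identityʳ n) x∈) , (λ i → sym (ℤP.+-identityʳ (x i)))
    decompose n K<n (suc ℓ) x x∈ =
      let y , y∈ , rest∈ = InDilate-split n (suc ℓ ℕ.* n) (ℕP.≤-trans K<n (ℕP.m≤m+n n (ℓ ℕ.* n))) x x∈
          ys , ys∈ , rest≡Σ = decompose n K<n ℓ (x -ᵥ y) rest∈
      in (y ∷ ys) , (λ { zero → y∈ ; (suc t) → ys∈ t }) ,
         (λ i → trans (i≡j+[i-j] (x i) (y i)) (cong (λ s → y i ℤ.+ s) (rest≡Σ i)))

    ones : ℤᵈ
    ones _ = + 1

    ones∈InDilate : 1 ℕ.≤ m → (∀ j → w (inject₁ j) ℤ.≤ + m) → InDilate (suc K) ones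
    ones∈InDilate 1≤m w≤m = dilate (cone (ℤ.+≤+ ℕ.z≤n) (λ j → ℤP.i≤j⇒0≤j-i (subst₂ ℤ._≤_
        (sym (ℤP.*-identityˡ (w (inject₁ j)))) (sym (ℤP.*-identityʳ (+ m))) (w≤m j))))
      (begin
        level ones                                  ≡⟨ level-pairs ones ⟩
        + m ℤ.* sumℤ (pair-height ones) ℤ.+ + 1     ≡⟨ cong (λ s → + m ℤ.* s ℤ.+ + 1) (sumℤ-ones K) ⟩
        + m ℤ.* + K ℤ.+ + 1                         ≤⟨ ℤP.+-monoʳ-≤ (+ m ℤ.* + K) (ℤ.+≤+ 1≤m) ⟩
        + m ℤ.* + K ℤ.+ + m                       ≡⟨ m*K+m≡[1+K]*m ⟩
        + (suc K) ℤ.* + m                         ∎)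
      where
      open ℤP.≤-Reasoning

    top-one⇒K<N : (∀ j → + 1 ℤ.≤ w (inject₁ j)) → ∀ {N y} → InDilate N y → y top ≡ + 1 → suc K ℕ.≤ N
    top-one⇒K<N 1≤w {N} {y} (dilate (cone _ slack≥0) level≤) top≡1 =
      ℤP.drop‿+<+ (ℤP.*-cancelˡ-<-nonNeg (+ m) (ℤP.suc[i]≤j⇒i<j (begin
        + 1 ℤ.+ + m ℤ.* + K                       ≡⟨ ℤP.+-comm (+ 1) (+ m ℤ.* + K) ⟩
        + m ℤ.* + K ℤ.+ + 1                       ≤⟨ ℤP.+-mono-≤ (ℤP.*-monoˡ-≤-nonNeg (+ m) K≤Σheights) (ℤP.≤-reflexive (sym top≡1)) ⟩
        + m ℤ.* sumℤ (pair-height y) ℤ.+ y top    ≡⟨ level-pairs y ⟨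
        level y                                   ≤⟨ level≤ ⟩
        + N ℤ.* + m                               ≡⟨ ℤP.*-comm (+ N) (+ m) ⟩
        + m ℤ.* + N                               ∎)))
      where
      open ℤP.≤-Reasoning
      w≤my : ∀ j → w (inject₁ j) ℤ.≤ + m ℤ.* y (inject₁ j)
      w≤my j = 0≤-⇒≤ (subst (λ t → + 0 ℤ.≤ + m ℤ.* y (inject₁ j) ℤ.- t) (trans (cong (ℤ._* w (inject₁ j)) top≡1) (ℤP.*-identityˡ _)) (slack≥0 j))
      1≤y : ∀ j → + 1 ℤ.≤ y (inject₁ j)
      1≤y j = ℤP.i<j⇒suc[i]≤j (ℤP.*-cancelˡ-<-nonNeg (+ m)
        (subst (ℤ._< + m ℤ.* y (inject₁ j)) (sym (ℤP.*-zeroʳ (+ m))) (ℤP.<-≤-trans (ℤ.+<+ ℕP.≤-refl) (ℤP.≤-trans (1≤w j) (w≤my j)))))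
      1≤height : ∀ t → + 1 ℤ.≤ pair-height y t
      1≤height t = subst (λ s → + 1 ℤ.≤ y (inject₁ (p₁ t)) ℤ.+ y (inject₁ (p₂ t)) ℤ.- s) (sym top≡1)
        (ℤP.+-monoˡ-≤ (ℤ.- + 1) (ℤP.+-mono-≤ (1≤y (p₁ t)) (1≤y (p₂ t))))
      K≤Σheights : + K ℤ.≤ sumℤ (pair-height y)
      K≤Σheights = subst (ℤ._≤ sumℤ (pair-height y)) (sumℤ-ones K)
        (sumℤ-mono-≤ (λ _ → + 1) (pair-height y) 1≤height)

-- The polytope P

module Instance (k′ : ℕ) (a : Fin (suc k′) → ℕ) (m : ℕ) (1≤m : 1 ℕ.≤ m)
  (a-bounds : ∀ i → (1 ℕ.≤ a i) × (2 ℕ.* a i ℕ.≤ m)) where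

  k K D : ℕ
  k = suc (suc k′)
  K = suc k′
  D = dim k ∸ 1

  K+K≡D : K ℕ.+ K ≡ D
  K+K≡D = sym (trans (ℕP.+-suc k′ (suc (k′ ℕ.+ 0))) (cong suc (cong (k′ ℕ.+_) (cong suc (ℕP.+-identityʳ k′)))))

  2k∸3≡k′+K : 2 ℕ.* k ∸ 3 ≡ k′ ℕ.+ K
  2k∸3≡k′+K = trans (cong (_∸ 1) (ℕP.+-suc k′ (suc (k′ ℕ.+ 0)))) (cong (λ u → k′ ℕ.+ suc u) (ℕP.+-identityʳ k′))

  w : Fin (suc D) → ℤ
  w = wvert k a m

  V-unit : ∀ (j : Fin D) i → vert k a m (suc (inject₁ j)) i ≡ unit (inject₁ j) i
  V-unit j i with toℕ (inject₁ j) <? dim k ∸ 1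
  ... | yes _ = refl
  ... | no j≮D = ⊥-elim (j≮D (subst (ℕ._< D) (sym (toℕ-inject₁ j)) (toℕ<n j)))

  V-apex : ∀ i → vert k a m (suc (fromℕ D)) i ≡ w i
  V-apex i with toℕ (fromℕ D) <? dim k ∸ 1
  ... | yes D<D = ⊥-elim (ℕP.<-irrefl (toℕ-fromℕ D) D<D)
  ... | no _ = refl

  w-top : w (fromℕ D) ≡ + m
  w-top with toℕ (fromℕ D) <? k ∸ 1
  ... | yes D<K = ⊥-elim (ℕP.<⇒≱ D<K (subst (K ℕ.≤_) (sym (toℕ-fromℕ D)) (subst (K ℕ.≤_) K+K≡D (ℕP.m≤m+n K K))))
  ... | no _ with toℕ (fromℕ D) <? dim k ∸ 1
  ...   | yes D<D = ⊥-elim (ℕP.<-irrefl (toℕ-fromℕ D) D<D)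
  ...   | no _ = refl

  aAt<m : ∀ t → aAt k a t ℕ.< m
  aAt<m t with t <? k ∸ 1
  ... | yes t<K = half<m (a (fromℕ< t<K)) (proj₂ (a-bounds (fromℕ< t<K)))
    where
    half<m : ∀ x → 2 ℕ.* x ℕ.≤ m → x ℕ.< m
    half<m zero _ = 1≤m
    half<m (suc x) 2x≤m = ℕP.<-≤-trans (ℕP.m<m+n (suc x) (ℕ.s≤s ℕ.z≤n)) 2x≤m
  ... | no _ = 1≤m

  aAt-< : ∀ t (t<K : t ℕ.< K) → aAt k a t ≡ a (fromℕ< t<K)
  aAt-< t t<K with t <? k ∸ 1
  ... | yes _ = refl
  ... | no t≮K = ⊥-elim (t≮K t<K)

  w-low : ∀ i → toℕ i ℕ.< K → w i ≡ + aAt k a (toℕ i)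
  w-low i i<K with toℕ i <? k ∸ 1
  ... | yes i<K′ = cong +_ (aAt-< (toℕ i) i<K′)
  ... | no i≮K = ⊥-elim (i≮K i<K)

  w-high : ∀ i → K ℕ.≤ toℕ i → toℕ i ℕ.< D → w i ≡ + m ℤ.- + aAt k a (2 ℕ.* k ∸ 3 ∸ toℕ i)
  w-high i K≤i i<D with toℕ i <? k ∸ 1
  ... | yes i<K = ⊥-elim (ℕP.<⇒≱ i<K K≤i)
  ... | no _ with toℕ i <? dim k ∸ 1
  ...   | yes _ = refl
  ...   | no i≮D = ⊥-elim (i≮D i<D)

  1≤aAt : ∀ t → t ℕ.< K → 1 ℕ.≤ aAt k a t
  1≤aAt t t<K = subst (1 ℕ.≤_) (sym (aAt-< t t<K)) (proj₁ (a-bounds (fromℕ< t<K)))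

  w-bounds : ∀ (j : Fin D) → (+ 1 ℤ.≤ w (inject₁ j)) × (w (inject₁ j) ℤ.≤ + m)
  w-bounds j with toℕ j ℕ.<? K
  ... | yes j<K = subst (λ v → (+ 1 ℤ.≤ v) × (v ℤ.≤ + m)) (sym (w-low (inject₁ j) j′<K))
                    (ℤ.+≤+ (1≤aAt (toℕ (inject₁ j)) j′<K) , ℤ.+≤+ (ℕP.<⇒≤ (aAt<m (toℕ (inject₁ j)))))
    where
    j′<K : toℕ (inject₁ j) ℕ.< K
    j′<K = subst (ℕ._< K) (sym (toℕ-inject₁ j)) j<K
  ... | no j≮K = subst (λ v → (+ 1 ℤ.≤ v) × (v ℤ.≤ + m))
                   (sym (w-high (inject₁ j) (subst (K ℕ.≤_) (sym (toℕ-inject₁ j)) (ℕP.≮⇒≥ j≮K))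
                                            (subst (ℕ._< D) (sym (toℕ-inject₁ j)) (toℕ<n j))))
                   (complement-bounds (aAt<m (2 ℕ.* k ∸ 3 ∸ toℕ (inject₁ j))))
    where
    complement-bounds : ∀ {s} → s ℕ.< m → (+ 1 ℤ.≤ + m ℤ.- + s) × (+ m ℤ.- + s ℤ.≤ + m)
    complement-bounds {s} s<m =
      0≤-⇒≤ (subst (+ 0 ℤ.≤_) (reassoc (+ m) (+ s)) (<⇒0≤-suc (ℤ.+<+ s<m))) ,
      ℤP.i≤j⇒i-k≤j (+ s) ℤP.≤-refl
      where
      reassoc : ∀ m s → m ℤ.- (s ℤ.+ + 1) ≡ (m ℤ.- s) ℤ.- + 1
      reassoc = solve-∀

  -- With 0-based indices, coordinate t < K of w is a_{t+1} and coordinate 2K − 1 − t is m − a_{t+1}.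
  p₁ p₂ : Fin K → Fin D
  p₁ t = cast K+K≡D (t ↑ˡ K)
  p₂ t = cast K+K≡D (K ↑ʳ opposite t)

  sumℤ-pairs : ∀ (f : Fin D → ℤ) → sumℤ f ≡ sumℤ (λ t → f (p₁ t) ℤ.+ f (p₂ t))
  sumℤ-pairs f = begin
    sumℤ f                                                                  ≡⟨ sumℤ-cast K+K≡D f ⟩
    sumℤ (f ∘ cast K+K≡D)                                                   ≡⟨ sumℤ-↑ K K (f ∘ cast K+K≡D) ⟩
    sumℤ (f ∘ p₁) ℤ.+ sumℤ (λ j → f (cast K+K≡D (K ↑ʳ j)))                 ≡⟨ cong (λ s → sumℤ (f ∘ p₁) ℤ.+ s) (sumℤ-opposite (λ j → f (cast K+K≡D (K ↑ʳ j)))) ⟩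
    sumℤ (f ∘ p₁) ℤ.+ sumℤ (f ∘ p₂)                                        ≡⟨ sumℤ-distrib-+ (f ∘ p₁) (f ∘ p₂) ⟨
    sumℤ (λ t → f (p₁ t) ℤ.+ f (p₂ t))                                     ∎
    where open ≡-Reasoning

  toℕ-p₁ : ∀ t → toℕ (inject₁ (p₁ t)) ≡ toℕ t
  toℕ-p₁ t = trans (toℕ-inject₁ (p₁ t)) (trans (toℕ-cast K+K≡D (t ↑ˡ K)) (toℕ-↑ˡ t K))

  toℕ-p₂ : ∀ t → toℕ (inject₁ (p₂ t)) ≡ K ℕ.+ (K ∸ suc (toℕ t))
  toℕ-p₂ t = trans (toℕ-inject₁ (p₂ t))
    (trans (toℕ-cast K+K≡D (K ↑ʳ opposite t)) (trans (toℕ-↑ʳ K (opposite t)) (cong (K ℕ.+_) (opposite-prop t))))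

  mirror : ∀ s → s ℕ.< K → 2 ℕ.* k ∸ 3 ∸ (K ℕ.+ (K ∸ suc s)) ≡ s
  mirror s (ℕ.s≤s s≤k′) = begin
    2 ℕ.* k ∸ 3 ∸ (K ℕ.+ (k′ ∸ s))   ≡⟨ cong (_∸ (K ℕ.+ (k′ ∸ s))) 2k∸3≡k′+K ⟩
    k′ ℕ.+ K ∸ (K ℕ.+ (k′ ∸ s))       ≡⟨ ℕP.∸-+-assoc (k′ ℕ.+ K) K (k′ ∸ s) ⟨
    k′ ℕ.+ K ∸ K ∸ (k′ ∸ s)           ≡⟨ cong (_∸ (k′ ∸ s)) (ℕP.m+n∸n≡m k′ K) ⟩
    k′ ∸ (k′ ∸ s)                     ≡⟨ ℕP.m∸[m∸n]≡n s≤k′ ⟩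
    s                                 ∎
    where open ≡-Reasoning

  w-pairs : ∀ t → w (inject₁ (p₁ t)) ℤ.+ w (inject₁ (p₂ t)) ≡ + m
  w-pairs t = begin
    w (inject₁ (p₁ t)) ℤ.+ w (inject₁ (p₂ t))
      ≡⟨ cong₂ ℤ._+_ (trans (w-low (inject₁ (p₁ t)) low) (cong (λ u → + aAt k a u) (toℕ-p₁ t)))
                     (trans (w-high (inject₁ (p₂ t)) high₁ high₂)
                            (cong (λ u → + m ℤ.- + aAt k a u) (trans (cong (2 ℕ.* k ∸ 3 ∸_) (toℕ-p₂ t)) (mirror (toℕ t) (toℕ<n t))))) ⟩
    + aAt k a (toℕ t) ℤ.+ (+ m ℤ.- + aAt k a (toℕ t))
      ≡⟨ cancel (+ m) (+ aAt k a (toℕ t)) ⟩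
    + m ∎
    where
    open ≡-Reasoning
    cancel : ∀ m x → x ℤ.+ (m ℤ.- x) ≡ m
    cancel = solve-∀
    low : toℕ (inject₁ (p₁ t)) ℕ.< K
    low = subst (ℕ._< K) (sym (toℕ-p₁ t)) (toℕ<n t)
    high₁ : K ℕ.≤ toℕ (inject₁ (p₂ t))
    high₁ = subst (K ℕ.≤_) (sym (toℕ-p₂ t)) (ℕP.m≤m+n K _)
    high₂ : toℕ (inject₁ (p₂ t)) ℕ.< D
    high₂ = subst (ℕ._< D) (sym (toℕ-p₂ t)) (subst (K ℕ.+ (K ∸ suc (toℕ t)) ℕ.<_) K+K≡D
      (ℕP.+-monoʳ-< K (ℕP.≤-<-trans (ℕP.m∸n≤m k′ (toℕ t)) (ℕP.n<1+n k′))))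

proposition2p1 : (k : ℕ) → 2 ≤ k → (a : Fin (k ∸ 1) → ℕ) → (m : ℕ) → 2 ≤ m →
    (∀ i → (1 ≤ a i) × (2 * a i ≤ m) × (gcd (a i) m ≡ 1)) →
    (n : ℕ) → 1 ≤ n → (IDP (dil n (P k a m)) ⇔ (k ≤ n))
proposition2p1 (suc (suc k′)) (ℕ.s≤s (ℕ.s≤s _)) a m 2≤m a-conditions n 1≤n = mk⇔ IDP⇒k≤n k≤n⇒IDP
  where
  1≤m : 1 ℕ.≤ m
  1≤m = ℕP.≤-trans (ℕP.n≤1+n 1) 2≤m

  open Instance k′ a m 1≤m (λ i → proj₁ (a-conditions i) , proj₁ (proj₂ (a-conditions i)))
  open Simplex w m w-top
  open Vertices (vert k a m) (λ _ → refl) V-unit V-apex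
  open Paired K p₁ p₂ sumℤ-pairs w-pairs

  k≤n⇒IDP : k ℕ.≤ n → IDP (dil n (P k a m))
  k≤n⇒IDP k≤n (suc ℓ) _ γ γ∈ =
    let ys , ys∈ , γ≡Σys = decompose n k≤n ℓ γ
          (∈dil⇒InDilate (suc ℓ ℕ.* n) γ (dil-dil⇒dil-* (P k a m) (suc ℓ) n (toQ γ) γ∈))
    in ys , (λ t → InDilate⇒∈dil n 1≤n 1≤m (ys t) (ys∈ t)) , γ≡Σys

  k≤k*n : k ℕ.≤ k ℕ.* n
  k≤k*n = subst (ℕ._≤ k ℕ.* n) (ℕP.*-identityʳ k) (ℕP.*-monoʳ-≤ k 1≤n)

  ones∈k·nP : dil k (dil n (P k a m)) (toQ ones)
  ones∈k·nP = dil-*⇒dil-dil (P k a m) k n (toQ ones)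
    (InDilate⇒∈dil (k ℕ.* n) (ℕP.≤-trans (ℕ.s≤s ℕ.z≤n) k≤k*n) 1≤m ones
      (InDilate-mono k≤k*n (ones∈InDilate 1≤m (proj₂ ∘ w-bounds))))

  IDP⇒k≤n : IDP (dil n (P k a m)) → k ℕ.≤ n
  IDP⇒k≤n idp =
    let ys , ys∈ , ones≡Σys = idp k (ℕ.s≤s ℕ.z≤n) ones ones∈k·nP
        pieces = λ t → ∈dil⇒InDilate n (ys t) (ys∈ t)
        t , top≡1 = sumℤ≡1⇒∃≡1 (λ t → ys t top) (λ t → top-nonNeg (in-cone (pieces t))) (sym (ones≡Σys top))
    in top-one⇒K<N (proj₁ ∘ w-bounds) (pieces t) top≡1
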